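{- Let $P$ be a domain. A subset $B\subseteq P$ is a basis of $P$ if and only if $B$ is a core basis of the Scott space $(P,\sigma P)$. Consequently, via $(P,B)\mapsto((P,\sigma P),B)$, the based domains correspond bijectively to the pairs consisting of a sober space and a core basis of it.
   Context: A domain is a poset in which every directed subset has a join. $x\ll y$ iff every directed $D$ with $y\le\bigvee D$ contains some $d\ge x$. A basis of a domain $P$ is a subset $B$ such that for each $y\in P$ the set $\{b\in B:b\ll y\}$ is directed with join $y$; a based domain is a pair of a domain and a basis of it. The Scott topology $\sigma P$ consists of upper sets $U$ meeting every directed set whose join lies in $U$. For a space $(X,\mathcal S)$ with specialization order $x\le y\iff x\in\mathrm{cl}\{y\}$, the core of $x$ is $\uparrow x=\{y:x\le y\}$; a core basis is a subset $B\subseteq X$ such that for all $U\in\mathcal S$ and $y\in U$ there is $x\in B$ with $y\in\mathrm{int}_{\mathcal S}(\uparrow x)\subseteq\uparrow x\subseteq U$. A sober space is a T$_0$ space in which every irreducible closed set is the closure of a point. -}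

module Defs where

open import Level using (Level; 0ℓ; _⊔_) renaming (suc to lsuc)
import Data.Unit.Polymorphic
open import Data.Product using (Σ; _×_; _,_; ∃)
open import Data.Sum using (_⊎_)
open import Relation.Nullary using (¬_)
open import Relation.Unary using (Pred; _∈_; _⊆_; _∩_; _∪_; ∁)
open import Relation.Binary.PropositionalEquality using (_≡_)
open import Relation.Binary.Structures using (IsPartialOrder)

Subset : Set → Set₁
Subset X = Pred X 0ℓ

_≐_ : {X : Set} {a b : Level} → Pred X a → Pred X b → Set (a ⊔ b)
A ≐ B = (A ⊆ B) × (B ⊆ A)

module _ {X : Set} (_≤_ : X → X → Set) where

  Directed : {ℓ : Level} → Pred X ℓ → Set ℓ
  Directed D = (Σ X λ d → d ∈ D)
             × (∀ {a b} → a ∈ D → b ∈ D → Σ X λ c → c ∈ D × (a ≤ c) × (b ≤ c))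

  IsJoin : {ℓ : Level} → Pred X ℓ → X → Set ℓ
  IsJoin A y = (∀ {a} → a ∈ A → a ≤ y) × (∀ z → (∀ {a} → a ∈ A → a ≤ z) → y ≤ z)

-- A domain (= dcpo) structure on the carrier X: a partial order in which
-- every directed subset has a join.
record Domain (X : Set) : Set₁ where
  field
    _≤_       : X → X → Set
    isPartialOrder : IsPartialOrder _≡_ _≤_
    ⋁         : (D : Subset X) → Directed _≤_ D → X
    ⋁-isJoin  : (D : Subset X) (d : Directed _≤_ D) → IsJoin _≤_ D (⋁ D d)

module _ {X : Set} (P : Domain X) where
  open Domain P

  _≪_ : X → X → Set₁
  x ≪ y = (D : Subset X) (dir : Directed _≤_ D) → y ≤ ⋁ D dir →
          Σ X λ d → d ∈ D × (x ≤ d)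

  IsBasis : Subset X → Set₁
  IsBasis B = ∀ y → Directed _≤_ (λ b → b ∈ B × (b ≪ y))
                  × IsJoin _≤_ (λ b → b ∈ B × (b ≪ y)) y

  ScottOpen : Subset X → Set₁
  ScottOpen U = (∀ {x y} → x ≤ y → x ∈ U → y ∈ U)
              × ((D : Subset X) (dir : Directed _≤_ D) → ⋁ D dir ∈ U →
                  Σ X λ d → d ∈ D × d ∈ U)

module _ {X : Set} (𝒪 : Subset X → Set₁) where

  -- 𝒪 is a topology on X (openness is required to be invariant under
  -- extensional equality of subsets, since subsets are predicates)
  record IsTopology : Set₂ where
    field
      ext       : ∀ {U V} → U ≐ V → 𝒪 U → 𝒪 V
      whole     : 𝒪 (λ _ → Data.Unit.Polymorphic.⊤)
      inter     : ∀ {U V} → 𝒪 U → 𝒪 V → 𝒪 (U ∩ V)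
      union     : (I : Set) (U : I → Subset X) → (∀ i → 𝒪 (U i)) →
                  𝒪 (λ x → Σ I λ i → x ∈ U i)

  Closed : Subset X → Set₁
  Closed A = 𝒪 (∁ A)

  cl : Subset X → Pred X (lsuc 0ℓ)
  cl A x = ∀ U → 𝒪 U → x ∈ U → Σ X λ a → a ∈ A × a ∈ U

  int : {ℓ : Level} → Pred X ℓ → Pred X (lsuc 0ℓ ⊔ ℓ)
  int A x = Σ (Subset X) λ U → 𝒪 U × U ⊆ A × x ∈ U

  _⊑_ : X → X → Set₁
  x ⊑ y = x ∈ cl (λ z → z ≡ y)

  ↑ : X → Pred X (lsuc 0ℓ)
  ↑ x y = x ⊑ y

  IsCoreBasis : Subset X → Set₁
  IsCoreBasis B = ∀ U → 𝒪 U → ∀ {y} → y ∈ U →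
                  Σ X λ x → x ∈ B × y ∈ int (↑ x) × ↑ x ⊆ U

  T₀ : Set₁
  T₀ = ∀ {x y} → x ⊑ y → y ⊑ x → x ≡ y

  Irreducible : Subset X → Set₁
  Irreducible A = (Σ X λ a → a ∈ A)
                × (∀ C₁ C₂ → Closed C₁ → Closed C₂ → A ⊆ C₁ ∪ C₂ →
                    (A ⊆ C₁) ⊎ (A ⊆ C₂))

  Sober : Set₁
  Sober = T₀ × (∀ A → Closed A → Irreducible A →
                  Σ X λ x → A ≐ cl (λ z → z ≡ x))

module Submission where

-- The specialisation order of the Scott topology
-- is the order of the domain. If B is a basis, interpolation makes each ⇈b = {z | b ≪ z}
-- Scott open, and these sets exhibit B as a core basis; conversely, for a core basis B
-- the c ∈ B with y ∈ int ↑c are way below y and form a directed set with join y.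
-- A sober space is a domain in its specialisation order, the join of a directed set D
-- being the generic point of the irreducible closed set cl D; a core basis then shows
-- that every Scott open set is a union of open sets, so the two topologies coincide.

open import Defs
open import Level using (Level)
open import Axiom.ExcludedMiddle using (ExcludedMiddle)
open import Axiom.DoubleNegationElimination using (em⇒dne)
open import Data.Product using (Σ; _×_; _,_; proj₁; proj₂)
open import Data.Empty using (⊥-elim)
open import Data.Sum using (_⊎_; inj₁; inj₂; [_,_]′)
import Data.Unit.Polymorphic as Poly
open import Relation.Nullary using (¬_; yes; no)
open import Relation.Nullary.Decidable using (True; toWitness; fromWitness)
open import Relation.Unary using (Pred; _∈_; _∉_; _⊆_; _∩_; _∪_; ∁)
open import Relation.Binary.PropositionalEquality using (_≡_; refl; isEquivalence)
open import Relation.Binary.Structures using (IsPartialOrder)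

private
  variable
    a b ℓ : Level
    X : Set

DirectedJoin : (X → X → Set) → Pred X ℓ → X → Set ℓ
DirectedJoin _≤_ A y = Directed _≤_ A × IsJoin _≤_ A y

DirectedJoin-≐ : {_≤_ : X → X → Set} {A : Pred X a} {A′ : Pred X b} {y : X} →
                 A ≐ A′ → DirectedJoin _≤_ A y → DirectedJoin _≤_ A′ y
DirectedJoin-≐ (f , g) (((d , dA) , bound) , (ub , least)) =
  ((d , f dA) , λ a b → let (c , cA , a≤c , b≤c) = bound (g a) (g b) in c , f cA , a≤c , b≤c) ,
  (λ a → ub (g a)) , (λ z h → least z (λ a → h (f a)))

DirectedJoin-⇔ : {_≤_ _≤′_ : X → X → Set} {A : Pred X a} {y : X} →
                 (∀ {x y} → x ≤ y → x ≤′ y) → (∀ {x y} → x ≤′ y → x ≤ y) →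
                 DirectedJoin _≤_ A y → DirectedJoin _≤′_ A y
DirectedJoin-⇔ f g ((nonempty , bound) , (ub , least)) =
  (nonempty , λ a b → let (c , cA , a≤c , b≤c) = bound a b in c , cA , f a≤c , f b≤c) ,
  (λ a → f (ub a)) , (λ z h → f (least z (λ a → g (h a))))

infix 4 _⊑⟨_⟩_
_⊑⟨_⟩_ : X → (Subset X → Set₁) → X → Set₁
x ⊑⟨ 𝒪 ⟩ y = _⊑_ 𝒪 x y

SameOpens : (𝒪 𝒪′ : Subset X → Set₁) → Set₁
SameOpens 𝒪 𝒪′ = ∀ U → (𝒪 U → 𝒪′ U) × (𝒪′ U → 𝒪 U)

SameOpens-sym : {𝒪 𝒪′ : Subset X → Set₁} → SameOpens 𝒪 𝒪′ → SameOpens 𝒪′ 𝒪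
SameOpens-sym same U = proj₂ (same U) , proj₁ (same U)

⊑-transfer : {𝒪 𝒪′ : Subset X → Set₁} → SameOpens 𝒪 𝒪′ → ∀ {x y} → x ⊑⟨ 𝒪 ⟩ y → x ⊑⟨ 𝒪′ ⟩ y
⊑-transfer same x⊑y U oU = x⊑y U (proj₂ (same U) oU)

IsCoreBasis-transfer : {𝒪 𝒪′ : Subset X → Set₁} → SameOpens 𝒪 𝒪′ → ∀ {B} →
                       IsCoreBasis 𝒪 B → IsCoreBasis 𝒪′ B
IsCoreBasis-transfer same cb U oU yU =
  let (x , xB , (W , oW , W⊆↑x , yW) , ↑x⊆U) = cb U (proj₂ (same U) oU) yU
  in x , xB , (W , proj₁ (same W) oW , (λ wW → ⊑-transfer same (W⊆↑x wW)) , yW) ,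
     λ x⊑z → ↑x⊆U (⊑-transfer (SameOpens-sym same) x⊑z)

infix 4 _≪⟨_⟩_
_≪⟨_⟩_ : X → Domain X → X → Set₁
x ≪⟨ P ⟩ y = _≪_ P x y

module DcpoProperties {X : Set} (P : Domain X) where
  open Domain P
  open IsPartialOrder isPartialOrder using () renaming (refl to ≤-refl; trans to ≤-trans)

  isJoin⇒≤⋁ : ∀ {D dir y} → IsJoin _≤_ D y → y ≤ ⋁ D dir
  isJoin⇒≤⋁ {D} {dir} (_ , least) = least _ (proj₁ (⋁-isJoin D dir))

  ≪⇒≤ : ∀ {x y} → x ≪⟨ P ⟩ y → x ≤ y
  ≪⇒≤ {x} {y} x≪y = singleton-below (x≪y (_≡ y) singleton-directed (isJoin⇒≤⋁ singleton-isJoin))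
    where
      singleton-directed : Directed _≤_ (_≡ y)
      singleton-directed = (y , refl) , λ { refl refl → y , refl , ≤-refl , ≤-refl }
      singleton-isJoin : IsJoin _≤_ (_≡ y) y
      singleton-isJoin = (λ { refl → ≤-refl }) , λ _ above → above refl
      singleton-below : (Σ X λ d → d ≡ y × x ≤ d) → x ≤ y
      singleton-below (_ , refl , x≤y) = x≤y

  ≤-≪-trans : ∀ {x y z} → x ≤ y → y ≪⟨ P ⟩ z → x ≪⟨ P ⟩ z
  ≤-≪-trans x≤y y≪z D dir z≤⋁D = let (d , dD , y≤d) = y≪z D dir z≤⋁D in d , dD , ≤-trans x≤y y≤d

  ≪-≤-trans : ∀ {x y z} → x ≪⟨ P ⟩ y → y ≤ z → x ≪⟨ P ⟩ z
  ≪-≤-trans x≪y y≤z D dir z≤⋁D = x≪y D dir (≤-trans y≤z z≤⋁D)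

  wayBelow-⊇-directedJoin : ∀ {E : Subset X} {A : Pred X ℓ} {y} → DirectedJoin _≤_ E y → E ⊆ A →
                            (∀ {a} → a ∈ A → a ≪⟨ P ⟩ y) → DirectedJoin _≤_ A y
  wayBelow-⊇-directedJoin {E = E} {A} {y} (dir@((e , eE) , bound) , join@(_ , least)) E⊆A A≪y =
    ((e , E⊆A eE) , bound′) , (λ aA → ≪⇒≤ (A≪y aA)) , λ z above → least z (λ eE → above (E⊆A eE))
    where
      y≤⋁E : y ≤ ⋁ E dir
      y≤⋁E = isJoin⇒≤⋁ join
      bound′ : ∀ {a₁ a₂} → a₁ ∈ A → a₂ ∈ A → Σ X λ c → c ∈ A × a₁ ≤ c × a₂ ≤ c
      bound′ a₁A a₂A =
        let (e₁ , e₁E , a₁≤e₁) = A≪y a₁A E dir y≤⋁E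
            (e₂ , e₂E , a₂≤e₂) = A≪y a₂A E dir y≤⋁E
            (c , cE , e₁≤c , e₂≤c) = bound e₁E e₂E
        in c , E⊆A cE , ≤-trans a₁≤e₁ e₁≤c , ≤-trans a₂≤e₂ e₂≤c

  ≤⇒⊑ : ∀ {x y} → x ≤ y → x ⊑⟨ ScottOpen P ⟩ y
  ≤⇒⊑ {y = y} x≤y U (upper , _) xU = y , refl , upper x≤y xU

  scott-isTopology : IsTopology (ScottOpen P)
  scott-isTopology = record { ext = ext ; whole = whole ; inter = inter ; union = union }
    where
      ext : ∀ {U V} → U ≐ V → ScottOpen P U → ScottOpen P V
      ext (U⊆V , V⊆U) (upper , inaccessible) =
        (λ x≤y xV → U⊆V (upper x≤y (V⊆U xV))) ,
        λ D dir ⋁D∈V → let (d , dD , dU) = inaccessible D dir (V⊆U ⋁D∈V) in d , dD , U⊆V dU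
      whole : ScottOpen P (λ _ → Poly.⊤)
      whole = (λ _ _ → _) , λ D ((d , dD) , _) _ → d , dD , _
      inter : ∀ {U V} → ScottOpen P U → ScottOpen P V → ScottOpen P (U ∩ V)
      inter (upperU , inaccU) (upperV , inaccV) =
        (λ x≤y (xU , xV) → upperU x≤y xU , upperV x≤y xV) ,
        λ D dir@(_ , bound) (⋁U , ⋁V) →
          let (d₁ , d₁D , d₁U) = inaccU D dir ⋁U
              (d₂ , d₂D , d₂V) = inaccV D dir ⋁V
              (d , dD , d₁≤d , d₂≤d) = bound d₁D d₂D
          in d , dD , upperU d₁≤d d₁U , upperV d₂≤d d₂V
      union : (I : Set) (U : I → Subset X) → (∀ i → ScottOpen P (U i)) →
              ScottOpen P (λ x → Σ I λ i → x ∈ U i)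
      union I U open-U =
        (λ x≤y (i , xU) → i , proj₁ (open-U i) x≤y xU) ,
        λ D dir (i , ⋁U) → let (d , dD , dU) = proj₂ (open-U i) D dir ⋁U in d , dD , i , dU

module Classical (em : ∀ {ℓ} → ExcludedMiddle ℓ) where

  dne : {A : Set ℓ} → ¬ ¬ A → A
  dne = em⇒dne em

  -- Excluded middle makes every proposition equivalent to one in Set; this
  -- resizing is needed since joins ⋁ are only taken of subsets in Set.
  record ⌊_⌋ (A : Set ℓ) : Set where
    field certificate : True (em {P = A})

  resize : {A : Set ℓ} → A → ⌊ A ⌋
  resize a = record { certificate = fromWitness a }

  unresize : {A : Set ℓ} → ⌊ A ⌋ → A
  unresize r = toWitness (⌊_⌋.certificate r)

  ⌊_⌋ᵖ : Pred X ℓ → Subset X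
  ⌊ A ⌋ᵖ x = ⌊ A x ⌋

  ≐-⌊⌋ᵖ : {A : Pred X ℓ} → A ≐ ⌊ A ⌋ᵖ
  ≐-⌊⌋ᵖ = resize , unresize

  module Space {X : Set} (𝒪 : Subset X → Set₁) where

    infix 4 _⊑₀_
    _⊑₀_ : X → X → Set
    x ⊑₀ y = ⌊ x ⊑⟨ 𝒪 ⟩ y ⌋

    cl₀ : Subset X → Subset X
    cl₀ A = ⌊ cl 𝒪 A ⌋ᵖ

    ⊑-refl : ∀ {x} → x ⊑⟨ 𝒪 ⟩ x
    ⊑-refl {x} U oU xU = x , refl , xU

    open-upper : ∀ {U x y} → 𝒪 U → x ⊑⟨ 𝒪 ⟩ y → x ∈ U → y ∈ U
    open-upper oU x⊑y xU with x⊑y _ oU xU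
    ... | _ , refl , yU = yU

    ⊑-trans : ∀ {x y z} → x ⊑⟨ 𝒪 ⟩ y → y ⊑⟨ 𝒪 ⟩ z → x ⊑⟨ 𝒪 ⟩ z
    ⊑-trans x⊑y y⊑z U oU xU = y⊑z U oU (open-upper oU x⊑y xU)

    closed-lower : ∀ {C x y} → Closed 𝒪 C → x ⊑⟨ 𝒪 ⟩ y → y ∈ C → x ∈ C
    closed-lower oC x⊑y yC = dne λ x∉C → open-upper oC x⊑y x∉C yC

    ⊆-cl : ∀ {A} → A ⊆ cl 𝒪 A
    ⊆-cl aA U oU aU = _ , aA , aU

    cl-least : ∀ {A C} → Closed 𝒪 C → A ⊆ C → cl 𝒪 A ⊆ C
    cl-least oC A⊆C zA = dne λ z∉C →
      let (a , aA , a∉C) = zA _ oC z∉C in a∉C (A⊆C aA)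

    ∉cl⇒disjoint-open : ∀ {A z} → z ∉ cl 𝒪 A →
                        Σ (Subset X) λ U → 𝒪 U × z ∈ U × (∀ {a} → a ∈ A → a ∉ U)
    ∉cl⇒disjoint-open z∉clA = dne λ none → z∉clA λ U oU zU →
      dne λ disjoint → none (U , oU , zU , λ {a} aA aU → disjoint (a , aA , aU))

    ⋢⇒separating-open : ∀ {x y} → ¬ x ⊑⟨ 𝒪 ⟩ y → Σ (Subset X) λ U → 𝒪 U × x ∈ U × y ∉ U
    ⋢⇒separating-open x⋢y =
      let (U , oU , xU , disjoint) = ∉cl⇒disjoint-open x⋢y in U , oU , xU , disjoint refl

    coreNbhd : Subset X → X → Subset X
    coreNbhd B y = ⌊ (λ c → c ∈ B × int 𝒪 (↑ 𝒪 c) y) ⌋ᵖ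

    module _ (top : IsTopology 𝒪) where
      open IsTopology top

      open-if-neighbourhoods : ∀ {U} → (∀ {y} → y ∈ U → int 𝒪 U y) → 𝒪 U
      open-if-neighbourhoods {U} nbhd =
        ext (⋃W⊆U , U⊆⋃W) (union (Σ X (_∈ U)) (λ (y , yU) → proj₁ (nbhd yU))
                                              (λ (y , yU) → proj₁ (proj₂ (nbhd yU))))
        where
          ⋃W⊆U : ∀ {x} → (Σ (Σ X (_∈ U)) λ (y , yU) → x ∈ proj₁ (nbhd yU)) → x ∈ U
          ⋃W⊆U ((y , yU) , xW) = proj₁ (proj₂ (proj₂ (nbhd yU))) xW
          U⊆⋃W : ∀ {x} → x ∈ U → Σ (Σ X (_∈ U)) λ (y , yU) → x ∈ proj₁ (nbhd yU)
          U⊆⋃W xU = (_ , xU) , proj₂ (proj₂ (proj₂ (nbhd xU)))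

      cl₀-closed : ∀ A → Closed 𝒪 (cl₀ A)
      cl₀-closed A = open-if-neighbourhoods λ z∉clA →
        let (U , oU , zU , disjoint) = ∉cl⇒disjoint-open (λ zA → z∉clA (resize zA))
        in U , oU , avoids oU disjoint , zU
        where
          avoids : ∀ {U} → 𝒪 U → (∀ {a} → a ∈ A → a ∉ U) → U ⊆ ∁ (cl₀ A)
          avoids oU disjoint uU uA = let (a , aA , aU) = unresize uA _ oU uU in disjoint aA aU

      ∁-closed : ∀ {U} → 𝒪 U → Closed 𝒪 (∁ U)
      ∁-closed = ext ((λ xU x∉U → x∉U xU) , dne)

      irreducible-opens-meet : ∀ {A U₁ U₂ a₁ a₂} → Irreducible 𝒪 A → 𝒪 U₁ → 𝒪 U₂ →
                               a₁ ∈ A → a₁ ∈ U₁ → a₂ ∈ A → a₂ ∈ U₂ →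
                               Σ X λ a → a ∈ A × a ∈ U₁ × a ∈ U₂
      irreducible-opens-meet {A} {U₁} {U₂} (_ , split) oU₁ oU₂ a₁A a₁U a₂A a₂U = dne λ disjoint →
        [ (λ A⊆∁U₁ → A⊆∁U₁ a₁A a₁U) , (λ A⊆∁U₂ → A⊆∁U₂ a₂A a₂U) ]′
          (split (∁ U₁) (∁ U₂) (∁-closed oU₁) (∁-closed oU₂) (cover disjoint))
        where
          cover : ¬ (Σ X λ a → a ∈ A × a ∈ U₁ × a ∈ U₂) → A ⊆ ∁ U₁ ∪ ∁ U₂
          cover disjoint {a} aA with em {P = U₁ a}
          ... | yes aU₁ = inj₂ λ aU₂ → disjoint (a , aA , aU₁ , aU₂)
          ... | no a∉U₁ = inj₁ a∉U₁

      directed-cl₀-irreducible : ∀ {D} → Directed _⊑₀_ D → Irreducible 𝒪 (cl₀ D)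
      directed-cl₀-irreducible {D} ((d , dD) , bound) = (d , resize (⊆-cl dD)) , split
        where
          split : ∀ C₁ C₂ → Closed 𝒪 C₁ → Closed 𝒪 C₂ → cl₀ D ⊆ C₁ ∪ C₂ →
                  (cl₀ D ⊆ C₁) ⊎ (cl₀ D ⊆ C₂)
          split C₁ C₂ oC₁ oC₂ cover with em {P = D ⊆ C₁}
          ... | yes D⊆C₁ = inj₁ λ zD → cl-least oC₁ D⊆C₁ (unresize zD)
          ... | no D⊈C₁ = inj₂ λ zD → cl-least oC₂ D⊆C₂ (unresize zD)
            where
              -- Any e ∉ C₂ would force all of D into C₁, via upper bounds of e and each x ∈ D.
              D⊆C₂ : D ⊆ C₂
              D⊆C₂ eD = dne λ e∉C₂ → D⊈C₁ λ xD →
                let (c , cD , e⊑c , x⊑c) = bound eD xD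
                in [ closed-lower oC₁ (unresize x⊑c)
                   , (λ cC₂ → ⊥-elim (e∉C₂ (closed-lower oC₂ (unresize e⊑c) cC₂))) ]′
                     (cover (resize (⊆-cl cD)))

      coreNbhd-directedJoin : ∀ {B} → IsCoreBasis 𝒪 B → ∀ y → DirectedJoin _⊑₀_ (coreNbhd B y) y
      coreNbhd-directedJoin {B} cb y = (nonempty , bound) , (ub , least)
        where
          nonempty : Σ X (_∈ coreNbhd B y)
          nonempty = let (c , cB , y∈int↑c , _) = cb _ whole {y} _ in c , resize (cB , y∈int↑c)

          bound : ∀ {a b} → a ∈ coreNbhd B y → b ∈ coreNbhd B y →
                  Σ X λ c → c ∈ coreNbhd B y × a ⊑₀ c × b ⊑₀ c
          bound aE bE =
            let (_ , V₁ , oV₁ , V₁⊆↑a , yV₁) = unresize aE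
                (_ , V₂ , oV₂ , V₂⊆↑b , yV₂) = unresize bE
                (c , cB , y∈int↑c , ↑c⊆V₁∩V₂) = cb _ (inter oV₁ oV₂) (yV₁ , yV₂)
            in c , resize (cB , y∈int↑c) ,
               resize (V₁⊆↑a (proj₁ (↑c⊆V₁∩V₂ ⊑-refl))) ,
               resize (V₂⊆↑b (proj₂ (↑c⊆V₁∩V₂ ⊑-refl)))

          ub : ∀ {c} → c ∈ coreNbhd B y → c ⊑₀ y
          ub cE = let (_ , V , _ , V⊆↑c , yV) = unresize cE in resize (V⊆↑c yV)

          least : ∀ z → (∀ {c} → c ∈ coreNbhd B y → c ⊑₀ z) → y ⊑₀ z
          least z above = resize (dne λ y⋢z →
            let (U , oU , yU , z∉U) = ⋢⇒separating-open y⋢z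
                (c , cB , y∈int↑c , ↑c⊆U) = cb U oU yU
            in z∉U (↑c⊆U (unresize (above (resize (cB , y∈int↑c))))))

  module ScottSpace {X : Set} (P : Domain X) where
    open Domain P
    open IsPartialOrder isPartialOrder using (antisym) renaming (refl to ≤-refl; trans to ≤-trans)
    open DcpoProperties P
    open Space (ScottOpen P)

    ≰-scottOpen : ∀ y → ScottOpen P (λ z → ¬ z ≤ y)
    ≰-scottOpen y =
      (λ x≤z x≰y z≤y → x≰y (≤-trans x≤z z≤y)) ,
      λ D dir ⋁D≰y → dne λ D≤y → ⋁D≰y (proj₂ (⋁-isJoin D dir) y λ {d} dD →
                                         dne λ d≰y → D≤y (d , dD , d≰y))

    ⊑⇒≤ : ∀ {x y} → x ⊑⟨ ScottOpen P ⟩ y → x ≤ y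
    ⊑⇒≤ {y = y} x⊑y = dne λ x≰y → y≰y (x⊑y _ (≰-scottOpen y) x≰y)
      where
        y≰y : ¬ (Σ X λ z → z ≡ y × ¬ z ≤ y)
        y≰y (_ , refl , y≰y) = y≰y ≤-refl

    int-↑⇒≪ : ∀ {c y} → int (ScottOpen P) (↑ (ScottOpen P) c) y → c ≪⟨ P ⟩ y
    int-↑⇒≪ (V , (upper , inaccessible) , V⊆↑c , yV) D dir y≤⋁D =
      let (d , dD , dV) = inaccessible D dir (upper y≤⋁D yV) in d , dD , ⊑⇒≤ (V⊆↑c dV)

    core⇒basis : ∀ {B} → IsCoreBasis (ScottOpen P) B → IsBasis P B
    core⇒basis {B} cb y = wayBelow-⊇-directedJoin coreNbhd-≤-directedJoin coreNbhd⊆↡ proj₂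
      where
        coreNbhd-≤-directedJoin : DirectedJoin _≤_ (coreNbhd B y) y
        coreNbhd-≤-directedJoin =
          DirectedJoin-⇔ (λ x⊑y → ⊑⇒≤ (unresize x⊑y)) (λ x≤y → resize (≤⇒⊑ x≤y))
                         (coreNbhd-directedJoin scott-isTopology cb y)
        coreNbhd⊆↡ : coreNbhd B y ⊆ (λ b → b ∈ B × b ≪⟨ P ⟩ y)
        coreNbhd⊆↡ c∈ = let (cB , y∈int↑c) = unresize c∈ in cB , int-↑⇒≪ y∈int↑c

    module _ {B : Subset X} (basis : IsBasis P B) where

      ↡₀ : X → Subset X
      ↡₀ y = ⌊ (λ b → b ∈ B × b ≪⟨ P ⟩ y) ⌋ᵖ

      ↡₀-directedJoin : ∀ y → DirectedJoin _≤_ (↡₀ y) y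
      ↡₀-directedJoin y = DirectedJoin-≐ ≐-⌊⌋ᵖ (basis y)

      approximate : ∀ {x y} → x ≪⟨ P ⟩ y → Σ X λ b → (b ∈ B × b ≪⟨ P ⟩ y) × x ≤ b
      approximate {y = y} x≪y =
        let (dir , join) = ↡₀-directedJoin y
            (b , b∈↡y , x≤b) = x≪y (↡₀ y) dir (isJoin⇒≤⋁ join)
        in b , unresize b∈↡y , x≤b

      approximate₂ : ∀ {x₁ x₂ y} → x₁ ≪⟨ P ⟩ y → x₂ ≪⟨ P ⟩ y →
                     Σ X λ b → (b ∈ B × b ≪⟨ P ⟩ y) × x₁ ≤ b × x₂ ≤ b
      approximate₂ {y = y} x₁≪y x₂≪y =
        let (b₁ , b₁∈↡y , x₁≤b₁) = approximate x₁≪y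
            (b₂ , b₂∈↡y , x₂≤b₂) = approximate x₂≪y
            (b , b∈↡y , b₁≤b , b₂≤b) = proj₂ (proj₁ (basis y)) b₁∈↡y b₂∈↡y
        in b , b∈↡y , ≤-trans x₁≤b₁ b₁≤b , ≤-trans x₂≤b₂ b₂≤b

      ↡↡₀ : X → Subset X
      ↡↡₀ z = ⌊ (λ c → c ∈ B × Σ X λ b → (b ∈ B × b ≪⟨ P ⟩ z) × c ≪⟨ P ⟩ b) ⌋ᵖ

      ↡↡₀-directedJoin : ∀ z → DirectedJoin _≤_ (↡↡₀ z) z
      ↡↡₀-directedJoin z = (nonempty , bound) , ub , least
        where
          nonempty : Σ X (_∈ ↡↡₀ z)
          nonempty =
            let (b , b∈↡z) = proj₁ (proj₁ (basis z))
                (c , cB , c≪b) = proj₁ (proj₁ (basis b))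
            in c , resize (cB , b , b∈↡z , c≪b)

          bound : ∀ {c₁ c₂} → c₁ ∈ ↡↡₀ z → c₂ ∈ ↡↡₀ z → Σ X λ c → c ∈ ↡↡₀ z × c₁ ≤ c × c₂ ≤ c
          bound c₁∈ c₂∈ =
            let (_ , b₁ , (_ , b₁≪z) , c₁≪b₁) = unresize c₁∈
                (_ , b₂ , (_ , b₂≪z) , c₂≪b₂) = unresize c₂∈
                (b , b∈↡z , b₁≤b , b₂≤b) = approximate₂ b₁≪z b₂≪z
                (c , (cB , c≪b) , c₁≤c , c₂≤c) =
                  approximate₂ (≪-≤-trans c₁≪b₁ b₁≤b) (≪-≤-trans c₂≪b₂ b₂≤b)
            in c , resize (cB , b , b∈↡z , c≪b) , c₁≤c , c₂≤c

          ub : ∀ {c} → c ∈ ↡↡₀ z → c ≤ z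
          ub c∈ = let (_ , b , (_ , b≪z) , c≪b) = unresize c∈ in ≤-trans (≪⇒≤ c≪b) (≪⇒≤ b≪z)

          least : ∀ w → (∀ {c} → c ∈ ↡↡₀ z → c ≤ w) → z ≤ w
          least w above = proj₂ (proj₂ (basis z)) w λ {b} b∈↡z →
            proj₂ (proj₂ (basis b)) w λ (cB , c≪b) → above (resize (cB , b , b∈↡z , c≪b))

      interpolate : ∀ {x z} → x ≪⟨ P ⟩ z → Σ X λ b → b ∈ B × x ≪⟨ P ⟩ b × b ≪⟨ P ⟩ z
      interpolate {z = z} x≪z =
        let (dir , join) = ↡↡₀-directedJoin z
            (c , c∈ , x≤c) = x≪z (↡↡₀ z) dir (isJoin⇒≤⋁ join)
            (_ , b , (bB , b≪z) , c≪b) = unresize c∈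
        in b , bB , ≤-≪-trans x≤c c≪b , b≪z

      ⇈₀ : X → Subset X
      ⇈₀ x = ⌊ x ≪⟨ P ⟩_ ⌋ᵖ

      ⇈₀-scottOpen : ∀ x → ScottOpen P (⇈₀ x)
      ⇈₀-scottOpen x =
        (λ y≤z x≪y → resize (≪-≤-trans (unresize x≪y) y≤z)) ,
        λ D dir x≪⋁D →
          let (_ , _ , x≪b , b≪⋁D) = interpolate (unresize x≪⋁D)
              (d , dD , b≤d) = b≪⋁D D dir ≤-refl
          in d , dD , resize (≪-≤-trans x≪b b≤d)

      basis⇒core : IsCoreBasis (ScottOpen P) B
      basis⇒core U (upper , inaccessible) {y} yU =
        let (dir , join) = ↡₀-directedJoin y
            (b , b∈↡y , bU) = inaccessible (↡₀ y) dir (upper (isJoin⇒≤⋁ join) yU)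
            (bB , b≪y) = unresize b∈↡y
        in b , bB ,
           (⇈₀ b , ⇈₀-scottOpen b , (λ b≪z → ≤⇒⊑ (≪⇒≤ (unresize b≪z))) , resize b≪y) ,
           λ b⊑z → upper (⊑⇒≤ b⊑z) bU

      scott-sober : Sober (ScottOpen P)
      scott-sober = (λ x⊑y y⊑x → antisym (⊑⇒≤ x⊑y) (⊑⇒≤ y⊑x)) , genericPoint
        where
          -- The generic point of A is the join of the basis elements way below some point
          -- of A; irreducibility of A makes that set directed.
          genericPoint : ∀ A → Closed (ScottOpen P) A → Irreducible (ScottOpen P) A →
                         Σ X λ x → A ≐ cl (ScottOpen P) (_≡ x)
          genericPoint A closedA irreducibleA@((a₀ , a₀A) , _) = ⋁ D dir , A⊆↓⋁D , ↓⋁D⊆A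
            where
              lower : ∀ {x a} → x ≤ a → a ∈ A → x ∈ A
              lower x≤a = closed-lower closedA (≤⇒⊑ x≤a)

              D : Subset X
              D = ⌊ (λ b → b ∈ B × Σ X λ a → a ∈ A × b ≪⟨ P ⟩ a) ⌋ᵖ

              bound : ∀ {b₁ b₂} → b₁ ∈ D → b₂ ∈ D → Σ X λ b → b ∈ D × b₁ ≤ b × b₂ ≤ b
              bound b₁∈D b₂∈D =
                let (_ , a₁ , a₁A , b₁≪a₁) = unresize b₁∈D
                    (_ , a₂ , a₂A , b₂≪a₂) = unresize b₂∈D
                    (a , aA , b₁≪a , b₂≪a) =
                      irreducible-opens-meet scott-isTopology irreducibleA
                        (⇈₀-scottOpen _) (⇈₀-scottOpen _) a₁A (resize b₁≪a₁) a₂A (resize b₂≪a₂)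
                    (b , (bB , b≪a) , b₁≤b , b₂≤b) = approximate₂ (unresize b₁≪a) (unresize b₂≪a)
                in b , resize (bB , a , aA , b≪a) , b₁≤b , b₂≤b

              dir : Directed _≤_ D
              dir = let (b , bB , b≪a₀) = proj₁ (proj₁ (basis a₀))
                    in (b , resize (bB , a₀ , a₀A , b≪a₀)) , bound

              A⊆↓⋁D : A ⊆ cl (ScottOpen P) (_≡ ⋁ D dir)
              A⊆↓⋁D {a} aA = ≤⇒⊑ (proj₂ (proj₂ (basis a)) (⋁ D dir) λ (bB , b≪a) →
                                    proj₁ (⋁-isJoin D dir) (resize (bB , a , aA , b≪a)))

              ⋁D∈A : ⋁ D dir ∈ A
              ⋁D∈A = dne λ ⋁D∉A →
                let (d , d∈D , d∉A) = proj₂ closedA D dir ⋁D∉A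
                    (_ , a , aA , d≪a) = unresize d∈D
                in d∉A (lower (≪⇒≤ d≪a) aA)

              ↓⋁D⊆A : cl (ScottOpen P) (_≡ ⋁ D dir) ⊆ A
              ↓⋁D⊆A x⊑⋁D = lower (⊑⇒≤ x⊑⋁D) ⋁D∈A

  module SoberSpace {X : Set} {𝒪 : Subset X → Set₁} (top : IsTopology 𝒪) (sober : Sober 𝒪) where
    open Space 𝒪

    ⊑₀-isPartialOrder : IsPartialOrder _≡_ _⊑₀_
    ⊑₀-isPartialOrder = record
      { isPreorder = record
        { isEquivalence = isEquivalence
        ; reflexive = λ { refl → resize ⊑-refl }
        ; trans = λ x⊑y y⊑z → resize (⊑-trans (unresize x⊑y) (unresize y⊑z))
        }
      ; antisym = λ x⊑y y⊑x → proj₁ sober (unresize x⊑y) (unresize y⊑x)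
      }

    genericPoint : ∀ D → Directed _⊑₀_ D → Σ X λ x → cl₀ D ≐ cl 𝒪 (_≡ x)
    genericPoint D dir = proj₂ sober (cl₀ D) (cl₀-closed top D) (directed-cl₀-irreducible top dir)

    genericPoint-isJoin : ∀ D dir → IsJoin _⊑₀_ D (proj₁ (genericPoint D dir))
    genericPoint-isJoin D dir =
      let (x , clD⊆↓x , ↓x⊆clD) = genericPoint D dir
      in (λ dD → resize (clD⊆↓x (resize (⊆-cl dD)))) ,
         λ w above → cl-least (cl₀-closed top (_≡ w)) above (unresize (↓x⊆clD ⊑-refl))

    specialisationDomain : Domain X
    specialisationDomain = record
      { _≤_ = _⊑₀_
      ; isPartialOrder = ⊑₀-isPartialOrder
      ; ⋁ = λ D dir → proj₁ (genericPoint D dir)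
      ; ⋁-isJoin = genericPoint-isJoin
      }

    open DcpoProperties specialisationDomain using (isJoin⇒≤⋁)
    open ScottSpace specialisationDomain using (core⇒basis)

    open⇒scottOpen : ∀ {U} → 𝒪 U → ScottOpen specialisationDomain U
    open⇒scottOpen oU =
      (λ x⊑y → open-upper oU (unresize x⊑y)) ,
      λ D dir ⋁D∈U → unresize (proj₂ (proj₂ (genericPoint D dir)) ⊑-refl) _ oU ⋁D∈U

    module _ {B : Subset X} (cb : IsCoreBasis 𝒪 B) where

      scottOpen⇒open : ∀ {U} → ScottOpen specialisationDomain U → 𝒪 U
      scottOpen⇒open (upper , inaccessible) = open-if-neighbourhoods top λ {y} yU →
        let (dir , join) = coreNbhd-directedJoin top cb y
            (c , c∈ , cU) = inaccessible _ dir (upper (isJoin⇒≤⋁ join) yU)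
            (_ , V , oV , V⊆↑c , yV) = unresize c∈
        in V , oV , (λ vV → upper (resize (V⊆↑c vV)) cU) , yV

      scottOpen-same : SameOpens (ScottOpen specialisationDomain) 𝒪
      scottOpen-same U = scottOpen⇒open , open⇒scottOpen

      specialisationDomain-basis : IsBasis specialisationDomain B
      specialisationDomain-basis =
        core⇒basis (IsCoreBasis-transfer (SameOpens-sym scottOpen-same) cb)

  scottOpen-determines-≤ : (P Q : Domain X) → SameOpens (ScottOpen P) (ScottOpen Q) →
                           ∀ {x y} → Domain._≤_ P x y → Domain._≤_ Q x y
  scottOpen-determines-≤ P Q same x≤y =
    ScottSpace.⊑⇒≤ Q (⊑-transfer same (DcpoProperties.≤⇒⊑ P x≤y))

lemma8p1 : (∀ {ℓ : Level} → ExcludedMiddle ℓ) →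
    -- (1) B is a basis of P iff B is a core basis of (P, σP)
    ((X : Set) (P : Domain X) (B : Subset X) →
       (IsBasis P B → IsCoreBasis (ScottOpen P) B)
       × (IsCoreBasis (ScottOpen P) B → IsBasis P B))
    -- (2) the map (P,B) ↦ ((P,σP),B) lands in pairs (sober space, core basis)
    × ((X : Set) (P : Domain X) (B : Subset X) → IsBasis P B →
       IsTopology (ScottOpen P) × Sober (ScottOpen P)
       × IsCoreBasis (ScottOpen P) B)
    -- (3) injectivity: equal images force equal domain structures
    × ((X : Set) (P Q : Domain X) (B : Subset X) → IsBasis P B → IsBasis Q B →
       (∀ U → (ScottOpen P U → ScottOpen Q U) × (ScottOpen Q U → ScottOpen P U)) →
       ∀ x y → (Domain._≤_ P x y → Domain._≤_ Q x y)
               × (Domain._≤_ Q x y → Domain._≤_ P x y))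
    -- (4) surjectivity: every sober space with a core basis arises this way
    × ((X : Set) (𝒪 : Subset X → Set₁) (B : Subset X) →
       IsTopology 𝒪 → Sober 𝒪 → IsCoreBasis 𝒪 B →
       Σ (Domain X) λ P → IsBasis P B
         × (∀ U → (ScottOpen P U → 𝒪 U) × (𝒪 U → ScottOpen P U)))
lemma8p1 em =
    (λ X P B → basis⇒core P , core⇒basis P)
  , (λ X P B basis → DcpoProperties.scott-isTopology P , scott-sober P basis , basis⇒core P basis)
  , (λ X P Q B _ _ same x y →
       scottOpen-determines-≤ P Q same , scottOpen-determines-≤ Q P (SameOpens-sym same))
  , (λ X 𝒪 B top sober cb →
       specialisationDomain top sober ,
       specialisationDomain-basis top sober cb ,
       scottOpen-same top sober cb)
  where
    open Classical em
    open ScottSpace using (basis⇒core; core⇒basis; scott-sober)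
    open SoberSpace using (specialisationDomain; specialisationDomain-basis; scottOpen-same)
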